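{- Let $p>2$ be a prime and $r>1$ an integer with $r\equiv1\pmod{p-1}$, and put $t=v(r-1)$. Then for all $\lambda\in\mathbb{F}_p$: (1) $\sum_{\mu\in\mathbb{F}_p}([\mu]-[\lambda])^r\equiv -[\lambda]rp\pmod{p^{t+2}}$, and (2) $\sum_{\mu\in\mathbb{F}_p}([\mu]-[\lambda])^{r-1}\equiv p-1\pmod{p^{t+1}}$.
   Context: $v$ is the $p$-adic valuation with $v(p)=1$; for $\lambda\in\mathbb{F}_p$, $[\lambda]\in\mathbb{Z}_p$ denotes its Teichmüller lift; congruences are in $\mathbb{Z}_p$. -}

module Defs where

open import Function using (_∘_)
open import Data.Product using (_×_)
open import Data.Nat as ℕ using (ℕ; zero; suc)
open import Data.Fin using (Fin; toℕ) renaming (zero to fzero; suc to fsuc)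
open import Data.Integer as ℤ using (ℤ; +_; _-_; _^_)
open import Data.Integer.Divisibility as ℤD using ()
open import Data.Nat.Divisibility as ℕD using ()
open import Relation.Nullary using (¬_)

∑ : (n : ℕ) → (Fin n → ℤ) → ℤ
∑ zero    f = + 0
∑ (suc n) f = f fzero ℤ.+ ∑ n (f ∘ fsuc)

_≋_[mod_] : ℤ → ℤ → ℕ → Set
a ≋ b [mod m ] = (+ m) ℤD.∣ (a - b)

IsPVal : ℕ → ℕ → ℕ → Set
IsPVal p n t = (p ℕ.^ t) ℕD.∣ n × ¬ ((p ℕ.^ suc t) ℕD.∣ n)

-- T is (the reduction modulo p^N of) the Teichmüller lift on 𝔽_p = {0,…,p-1}:
-- T l lifts l, and T l is a root of x^p = x modulo p^N.  By Hensel's lemma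
-- (derivative p x^(p-1) - 1 is a unit) this determines T l uniquely mod p^N,
-- and it agrees with [l] mod p^N.
IsTeichmullerMod : (p N : ℕ) → (Fin p → ℤ) → Set
IsTeichmullerMod p N T =
  ((l : Fin p) → T l ≋ + toℕ l [mod p ]) ×
  ((l : Fin p) → (T l ^ p) ≋ T l [mod p ℕ.^ N ])

{-# OPTIONS --safe #-}
-- Write d μ = [μ] - [λ] and r - 1 = (p - 1) pᵗ m.  As d μ ≡ [μ - λ] mod p, lifting to p-th powers
-- gives d μ ^ p ≡ [μ - λ] mod p².  For μ ≠ λ the unit D = d μ ^ (p - 1) is ≡ 1 mod p, and since p
-- is odd (so p ∣ C(p,2)) the binomial theorem gives D ^ pᵗ ≡ 1 + pᵗ (D - 1) mod pᵗ⁺².  Hence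
-- d μ ^ (r - 1) ≡ 1 mod pᵗ⁺¹, and d μ ^ r ≡ d μ + m pᵗ ([μ - λ] - d μ) mod pᵗ⁺², which also holds
-- for μ = λ.  Summing over μ gives (2) at once.  For (1), μ ↦ μ - λ permutes 𝔽_p, and
-- ∑ [μ] ≡ 0 mod pᵗ⁺² because [-μ] = -[μ] (a root of xᵖ = x is determined by its residue and p is
-- odd), so that sum equals its own negative.
module Submission where

open import Defs
open import Data.Product using (_×_)
open import Data.Nat as ℕ using (ℕ; _∸_; _<_)
open import Data.Nat.Divisibility using (_∣_)
open import Data.Nat.Primality using (Prime)
open import Data.Fin using (Fin)
open import Data.Integer as ℤ using (ℤ; +_; _-_; _*_; -_; _^_)

open import Function using (_∘_)
open import Data.Empty using (⊥-elim)
open import Data.Product using (∃-syntax; _,_; proj₁; proj₂)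
open import Data.Sum using (_⊎_; inj₁; inj₂)
open import Data.Nat using (zero; suc; _≤_; s≤s)
import Data.Nat.Properties as ℕP
open import Data.Nat.Combinatorics using (_C_; nC1≡n; nCk+nC[k+1]≡[n+1]C[k+1])
open import Data.Nat.Divisibility using (divides; ∣m+n∣m⇒∣n; n∣m*n; n∣m⇒m%n≡0)
open import Data.Nat.DivMod using (_mod_; _divMod_; module DivMod; m<n⇒m%n≡m)
open import Data.Nat.Primality using (euclidsLemma; prime⇒irreducible)
import Data.Nat.Tactic.RingSolver as ℕ-Ring
open import Data.Fin using (toℕ; zero; suc)
open import Data.Fin.Properties using (toℕ<n; toℕ-injective; suc-injective; _≟_)
open import Data.Fin.Permutation using (permutation)
open import Data.Integer using (_+_; 0ℤ; 1ℤ)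
import Data.Integer.Properties as ℤP
open import Data.Integer.Divisibility.Signed
  using ( divides; ∣-refl; ∣-reflexive; ∣-trans; ∣m∣n⇒∣m+n; ∣m∣n⇒∣m-n; ∣m⇒∣-m; ∣n⇒∣m*n; ∣m⇒∣m*n
        ; *-monoʳ-∣; *-monoˡ-∣; ∣ᵤ⇒∣; ∣⇒∣ᵤ)
  renaming (_∣_ to _∣ℤ_)
open import Data.Integer.Tactic.RingSolver using (solve-∀)
import Algebra.Properties.CommutativeMonoid.Sum as MonoidSum
open import Relation.Binary.Bundles using (Setoid)
open import Relation.Binary.PropositionalEquality
  using (_≡_; _≢_; refl; sym; trans; cong; cong₂; subst; module ≡-Reasoning)
open import Relation.Nullary using (¬_; yes; no)

infix 4 _≡_[mod_]

-- A record rather than an abbreviation of n ∣ a - b, so that a, b and n are inferable.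
record _≡_[mod_] (a b n : ℤ) : Set where
  constructor congruent
  field difference-divisible : n ∣ℤ a - b
open _≡_[mod_]

module _ {n : ℤ} where

  mod-reflexive : ∀ {a b} → a ≡ b → a ≡ b [mod n ]
  mod-reflexive {a} refl = congruent (divides 0ℤ (trans (ℤP.+-inverseʳ a) (sym (ℤP.*-zeroˡ n))))

  mod-refl : ∀ {a} → a ≡ a [mod n ]
  mod-refl = mod-reflexive refl

  mod-sym : ∀ {a b} → a ≡ b [mod n ] → b ≡ a [mod n ]
  mod-sym {a} {b} (congruent n∣a-b) = congruent (subst (n ∣ℤ_) (lemma a b) (∣m⇒∣-m n∣a-b))
    where
    lemma : ∀ a b → - (a - b) ≡ b - a
    lemma = solve-∀

  mod-trans : ∀ {a b c} → a ≡ b [mod n ] → b ≡ c [mod n ] → a ≡ c [mod n ]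
  mod-trans {a} {b} {c} (congruent n∣a-b) (congruent n∣b-c) =
    congruent (subst (n ∣ℤ_) (lemma a b c) (∣m∣n⇒∣m+n n∣a-b n∣b-c))
    where
    lemma : ∀ a b c → (a - b) + (b - c) ≡ a - c
    lemma = solve-∀

  +-cong-mod : ∀ {a b c d} → a ≡ b [mod n ] → c ≡ d [mod n ] → a + c ≡ b + d [mod n ]
  +-cong-mod {a} {b} {c} {d} (congruent n∣a-b) (congruent n∣c-d) =
    congruent (subst (n ∣ℤ_) (lemma a b c d) (∣m∣n⇒∣m+n n∣a-b n∣c-d))
    where
    lemma : ∀ a b c d → (a - b) + (c - d) ≡ (a + c) - (b + d)
    lemma = solve-∀

  +-congˡ-mod : ∀ c {a b} → a ≡ b [mod n ] → c + a ≡ c + b [mod n ]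
  +-congˡ-mod c = +-cong-mod (mod-refl {c})

  -‿cong-mod : ∀ {a b} → a ≡ b [mod n ] → - a ≡ - b [mod n ]
  -‿cong-mod {a} {b} (congruent n∣a-b) = congruent (subst (n ∣ℤ_) (lemma a b) (∣m⇒∣-m n∣a-b))
    where
    lemma : ∀ a b → - (a - b) ≡ - a - - b
    lemma = solve-∀

  sub-cong-mod : ∀ {a b c d} → a ≡ b [mod n ] → c ≡ d [mod n ] → a - c ≡ b - d [mod n ]
  sub-cong-mod a≡b c≡d = +-cong-mod a≡b (-‿cong-mod c≡d)

  sub-congˡ-mod : ∀ c {a b} → a ≡ b [mod n ] → c - a ≡ c - b [mod n ]
  sub-congˡ-mod c = sub-cong-mod (mod-refl {c})

  sub-congʳ-mod : ∀ c {a b} → a ≡ b [mod n ] → a - c ≡ b - c [mod n ]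
  sub-congʳ-mod c a≡b = sub-cong-mod a≡b (mod-refl {c})

  *-cong-mod : ∀ {a b c d} → a ≡ b [mod n ] → c ≡ d [mod n ] → a * c ≡ b * d [mod n ]
  *-cong-mod {a} {b} {c} {d} (congruent n∣a-b) (congruent n∣c-d) =
    congruent (subst (n ∣ℤ_) (lemma a b c d) (∣m∣n⇒∣m+n (∣n⇒∣m*n c n∣a-b) (∣n⇒∣m*n b n∣c-d)))
    where
    lemma : ∀ a b c d → c * (a - b) + b * (c - d) ≡ a * c - b * d
    lemma = solve-∀

  *-congˡ-mod : ∀ c {a b} → a ≡ b [mod n ] → c * a ≡ c * b [mod n ]
  *-congˡ-mod c = *-cong-mod (mod-refl {c})

  ∣⇒≡0-mod : ∀ {a} → n ∣ℤ a → a ≡ 0ℤ [mod n ]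
  ∣⇒≡0-mod {a} n∣a = congruent (subst (n ∣ℤ_) (sym (ℤP.+-identityʳ a)) n∣a)

  ≡0-mod⇒∣ : ∀ {a} → a ≡ 0ℤ [mod n ] → n ∣ℤ a
  ≡0-mod⇒∣ {a} (congruent n∣a-0) = subst (n ∣ℤ_) (ℤP.+-identityʳ a) n∣a-0

mod-weaken : ∀ {m n a b} → m ∣ℤ n → a ≡ b [mod n ] → a ≡ b [mod m ]
mod-weaken m∣n (congruent n∣a-b) = congruent (∣-trans m∣n n∣a-b)

mod-*-scale : ∀ c {n a b} → a ≡ b [mod n ] → c * a ≡ c * b [mod c * n ]
mod-*-scale c {n} {a} {b} (congruent n∣a-b) = congruent (subst (c * n ∣ℤ_) (lemma c a b) (*-monoʳ-∣ c n∣a-b))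
  where
  lemma : ∀ c a b → c * (a - b) ≡ c * a - c * b
  lemma = solve-∀

∣-resp-mod : ∀ {m n a b} → a ≡ b [mod n ] → m ∣ℤ n → m ∣ℤ b → m ∣ℤ a
∣-resp-mod {a = a} {b} (congruent n∣a-b) m∣n m∣b = subst (_ ∣ℤ_) (lemma a b) (∣m∣n⇒∣m+n (∣-trans m∣n n∣a-b) m∣b)
  where
  lemma : ∀ a b → (a - b) + b ≡ a
  lemma = solve-∀

mod-setoid : ℤ → Setoid _ _
mod-setoid n = record
  { Carrier       = ℤ
  ; _≈_           = _≡_[mod n ]
  ; isEquivalence = record { refl = mod-refl ; sym = mod-sym ; trans = mod-trans }
  }

module ≡-mod-Reasoning (n : ℤ) where
  open import Relation.Binary.Reasoning.Setoid (mod-setoid n) public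

*-pres-∣ℤ : ∀ {a b c d} → a ∣ℤ b → c ∣ℤ d → a * c ∣ℤ b * d
*-pres-∣ℤ {b = b} {c} a∣b c∣d = ∣-trans (*-monoˡ-∣ c a∣b) (*-monoʳ-∣ b c∣d)

^-square-∣ : ∀ n k {y} → n ^ suc k ∣ℤ y → n ^ (2 ℕ.+ k) ∣ℤ y * y
^-square-∣ n k nᵏ⁺¹∣y =
  ∣-trans (*-monoˡ-∣ (n ^ suc k) (∣m⇒∣m*n (n ^ k) (∣-refl {n}))) (*-pres-∣ℤ nᵏ⁺¹∣y nᵏ⁺¹∣y)

^-∣-^-suc : ∀ n k → n ^ k ∣ℤ n ^ suc k
^-∣-^-suc n k = ∣n⇒∣m*n n (∣-refl {n ^ k})

^-suc-∣ : ∀ n k {x} → n ∣ℤ x → n ^ suc k ∣ℤ n ^ k * x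
^-suc-∣ n k {x} n∣x = subst (_∣ℤ n ^ k * x) (ℤP.*-comm (n ^ k) n) (*-monoʳ-∣ (n ^ k) n∣x)

^-∣-^-+ : ∀ n i j → n ^ i ∣ℤ n ^ (i ℕ.+ j)
^-∣-^-+ n i j = subst (n ^ i ∣ℤ_) (sym (ℤP.^-distribˡ-+-* n i j)) (∣m⇒∣m*n (n ^ j) (∣-refl {n ^ i}))

mod-^-scale : ∀ n i j {a b} → a ≡ b [mod n ^ i ] → n ^ j * a ≡ n ^ j * b [mod n ^ (i ℕ.+ j) ]
mod-^-scale n i j a≡b = subst (λ k → _ ≡ _ [mod k ]) nʲ*nⁱ≡nⁱ⁺ʲ (mod-*-scale (n ^ j) a≡b)
  where
  nʲ*nⁱ≡nⁱ⁺ʲ : n ^ j * n ^ i ≡ n ^ (i ℕ.+ j)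
  nʲ*nⁱ≡nⁱ⁺ʲ = trans (sym (ℤP.^-distribˡ-+-* n j i)) (cong (n ^_) (ℕP.+-comm j i))

0^-pos : ∀ {k} → 0 < k → 0ℤ ^ k ≡ 0ℤ
0^-pos {suc k} _ = refl

pos-^ : ∀ m k → + (m ℕ.^ k) ≡ (+ m) ^ k
pos-^ m zero    = refl
pos-^ m (suc k) = trans (ℤP.pos-* m (m ℕ.^ k)) (cong (+ m *_) (pos-^ m k))

-- Truncated binomial expansions and lifting of congruences

binomial-mod-square : ∀ n b c → (b + c) ^ suc n ≡ b ^ suc n + + suc n * b ^ n * c [mod c * c ]
binomial-mod-square zero    b c = mod-reflexive (lemma b c)
  where
  lemma : ∀ b c → (b + c) * 1ℤ ≡ b * 1ℤ + 1ℤ * 1ℤ * c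
  lemma = solve-∀
binomial-mod-square (suc n) b c = begin
  (b + c) * (b + c) ^ suc n                     ≈⟨ *-congˡ-mod (b + c) (binomial-mod-square n b c) ⟩
  (b + c) * (b ^ suc n + + suc n * b ^ n * c)   ≈⟨ congruent (divides (+ suc n * b ^ n) (lemma b c (b ^ n) (+ suc n))) ⟩
  b ^ suc (suc n) + + suc (suc n) * b ^ suc n * c ∎
  where
  open ≡-mod-Reasoning (c * c)
  lemma : ∀ b c B N → (b + c) * (b * B + N * B * c) - (b * (b * B) + (1ℤ + N) * (b * B) * c) ≡ N * B * (c * c)
  lemma = solve-∀

suc-C2 : ∀ n → suc n C 2 ≡ n ℕ.+ n C 2
suc-C2 n = trans (sym (nCk+nC[k+1]≡[n+1]C[k+1] n 1)) (cong (ℕ._+ n C 2) (nC1≡n n))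

binomial-mod-cube : ∀ n y → (1ℤ + y) ^ n ≡ 1ℤ + + n * y + + (n C 2) * (y * y) [mod y * y * y ]
binomial-mod-cube zero    y = mod-reflexive (lemma y)
  where
  lemma : ∀ y → 1ℤ ≡ 1ℤ + 0ℤ * y + 0ℤ * (y * y)
  lemma = solve-∀
binomial-mod-cube (suc n) y = begin
  (1ℤ + y) * (1ℤ + y) ^ n                               ≈⟨ *-congˡ-mod (1ℤ + y) (binomial-mod-cube n y) ⟩
  (1ℤ + y) * (1ℤ + + n * y + + (n C 2) * (y * y))       ≈⟨ congruent (divides (+ (n C 2)) (lemma y (+ n) (+ (n C 2)))) ⟩
  1ℤ + + suc n * y + (+ n + + (n C 2)) * (y * y)        ≡⟨ cong (λ k → 1ℤ + + suc n * y + + k * (y * y)) (sym (suc-C2 n)) ⟩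
  1ℤ + + suc n * y + + (suc n C 2) * (y * y)            ∎
  where
  open ≡-mod-Reasoning (y * y * y)
  lemma : ∀ y N C → (1ℤ + y) * (1ℤ + N * y + C * (y * y)) - (1ℤ + (1ℤ + N) * y + (N + C) * (y * y)) ≡ C * (y * y * y)
  lemma = solve-∀

odd-C2 : ∀ u → suc (u ℕ.+ u) C 2 ≡ suc (u ℕ.+ u) ℕ.* u
odd-C2 zero    = refl
odd-C2 (suc u) = begin
  suc (suc u ℕ.+ suc u) C 2                                 ≡⟨ cong (λ k → suc (suc k) C 2) (ℕP.+-suc u u) ⟩
  suc (suc (suc (u ℕ.+ u))) C 2                             ≡⟨ suc-C2 (suc (suc (u ℕ.+ u))) ⟩
  suc (suc (u ℕ.+ u)) ℕ.+ suc (suc (u ℕ.+ u)) C 2           ≡⟨ cong (suc (suc (u ℕ.+ u)) ℕ.+_) (suc-C2 (suc (u ℕ.+ u))) ⟩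
  suc (suc (u ℕ.+ u)) ℕ.+ (suc (u ℕ.+ u) ℕ.+ suc (u ℕ.+ u) C 2)
    ≡⟨ cong (λ k → suc (suc (u ℕ.+ u)) ℕ.+ (suc (u ℕ.+ u) ℕ.+ k)) (odd-C2 u) ⟩
  suc (suc (u ℕ.+ u)) ℕ.+ (suc (u ℕ.+ u) ℕ.+ suc (u ℕ.+ u) ℕ.* u) ≡⟨ lemma u ⟩
  suc (suc u ℕ.+ suc u) ℕ.* suc u                           ∎
  where
  open ≡-Reasoning
  lemma : ∀ u → suc (suc (u ℕ.+ u)) ℕ.+ (suc (u ℕ.+ u) ℕ.+ suc (u ℕ.+ u) ℕ.* u) ≡ suc (suc u ℕ.+ suc u) ℕ.* suc u
  lemma = ℕ-Ring.solve-∀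

^-lift-mod : ∀ p k {a b} → a ≡ b [mod (+ p) ^ suc k ] → a ^ p ≡ b ^ p [mod (+ p) ^ (2 ℕ.+ k) ]
^-lift-mod zero     k a≡b = mod-refl
^-lift-mod (suc p′) k {a} {b} a≡b@(congruent Pᵏ⁺¹∣a-b) = begin
  a ^ suc p′                                    ≡⟨ cong (_^ suc p′) (lemma a b) ⟩
  (b + (a - b)) ^ suc p′                        ≈⟨ mod-weaken (^-square-∣ P k Pᵏ⁺¹∣a-b) (binomial-mod-square p′ b (a - b)) ⟩
  b ^ suc p′ + P * b ^ p′ * (a - b)             ≈⟨ +-congˡ-mod (b ^ suc p′) (∣⇒≡0-mod Pᵏ⁺²∣linear-term) ⟩
  b ^ suc p′ + 0ℤ                               ≡⟨ ℤP.+-identityʳ (b ^ suc p′) ⟩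
  b ^ suc p′                                    ∎
  where
  open ≡-mod-Reasoning ((+ suc p′) ^ (2 ℕ.+ k))
  P : ℤ
  P = + suc p′
  lemma : ∀ a b → a ≡ b + (a - b)
  lemma = solve-∀
  Pᵏ⁺²∣linear-term : P ^ (2 ℕ.+ k) ∣ℤ P * b ^ p′ * (a - b)
  Pᵏ⁺²∣linear-term =
    subst (_ ∣ℤ_) (sym (ℤP.*-assoc P (b ^ p′) (a - b))) (*-monoʳ-∣ P (∣n⇒∣m*n (b ^ p′) Pᵏ⁺¹∣a-b))

root-of-xᵖ-x-unique : ∀ p k {a b} → a ≡ b [mod + p ] →
  a ^ p ≡ a [mod (+ p) ^ suc k ] → b ^ p ≡ b [mod (+ p) ^ suc k ] → a ≡ b [mod (+ p) ^ suc k ]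
root-of-xᵖ-x-unique p zero    a≡b _ _ = mod-weaken (∣-reflexive (ℤP.*-identityʳ (+ p))) a≡b
root-of-xᵖ-x-unique p (suc k) {a} {b} a≡b aᵖ≡a bᵖ≡b =
  mod-trans (mod-sym aᵖ≡a) (mod-trans (^-lift-mod p k a≡b[mod-Pᵏ⁺¹]) bᵖ≡b)
  where
  Pᵏ⁺¹∣Pᵏ⁺² : (+ p) ^ suc k ∣ℤ (+ p) ^ suc (suc k)
  Pᵏ⁺¹∣Pᵏ⁺² = ^-∣-^-suc (+ p) (suc k)
  a≡b[mod-Pᵏ⁺¹] : a ≡ b [mod (+ p) ^ suc k ]
  a≡b[mod-Pᵏ⁺¹] = root-of-xᵖ-x-unique p k a≡b (mod-weaken Pᵏ⁺¹∣Pᵏ⁺² aᵖ≡a) (mod-weaken Pᵏ⁺¹∣Pᵏ⁺² bᵖ≡b)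

aᵖ≡a⇒aᵖ⁻¹≡1 : ∀ {p′ a} → Prime (suc p′) → a ^ suc p′ ≡ a [mod + suc p′ ] → ¬ (+ suc p′ ∣ℤ a) →
  a ^ p′ ≡ 1ℤ [mod + suc p′ ]
aᵖ≡a⇒aᵖ⁻¹≡1 {p′} {a} p-prime (congruent p∣aᵖ-a) p∤a
  with euclidsLemma ℤ.∣ a ∣ ℤ.∣ a ^ p′ - 1ℤ ∣ p-prime p∣|a|*|aᵖ⁻¹-1|
  where
  lemma : ∀ a A → a * A - a ≡ a * (A - 1ℤ)
  lemma = solve-∀
  p∣|a|*|aᵖ⁻¹-1| : suc p′ ∣ ℤ.∣ a ∣ ℕ.* ℤ.∣ a ^ p′ - 1ℤ ∣
  p∣|a|*|aᵖ⁻¹-1| =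
    subst (suc p′ ∣_) (ℤP.abs-* a (a ^ p′ - 1ℤ)) (∣⇒∣ᵤ (subst (_ ∣ℤ_) (lemma a (a ^ p′)) p∣aᵖ-a))
... | inj₁ p∣|a|       = ⊥-elim (p∤a (∣ᵤ⇒∣ p∣|a|))
... | inj₂ p∣|aᵖ⁻¹-1| = congruent (∣ᵤ⇒∣ p∣|aᵖ⁻¹-1|)

x^m≡1+m[x-1] : ∀ m {n k x} → x ≡ 1ℤ [mod n ^ suc k ] → x ^ m ≡ 1ℤ + + m * (x - 1ℤ) [mod n ^ (2 ℕ.+ k) ]
x^m≡1+m[x-1] zero    {x = x} _ = mod-reflexive (lemma x)
  where
  lemma : ∀ x → 1ℤ ≡ 1ℤ + 0ℤ * (x - 1ℤ)
  lemma = solve-∀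
x^m≡1+m[x-1] (suc m) {n} {k} {x} (congruent nᵏ⁺¹∣x-1) = begin
  x ^ suc m                                        ≡⟨ cong (_^ suc m) (lemma x) ⟩
  (1ℤ + (x - 1ℤ)) ^ suc m                          ≈⟨ mod-weaken (^-square-∣ n k nᵏ⁺¹∣x-1) (binomial-mod-square m 1ℤ (x - 1ℤ)) ⟩
  1ℤ ^ suc m + + suc m * 1ℤ ^ m * (x - 1ℤ)
    ≡⟨ cong₂ (λ a b → a + + suc m * b * (x - 1ℤ)) (ℤP.^-zeroˡ (suc m)) (ℤP.^-zeroˡ m) ⟩
  1ℤ + + suc m * 1ℤ * (x - 1ℤ)                     ≡⟨ cong (λ a → 1ℤ + a * (x - 1ℤ)) (ℤP.*-identityʳ (+ suc m)) ⟩
  1ℤ + + suc m * (x - 1ℤ)                          ∎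
  where
  open ≡-mod-Reasoning (n ^ (2 ℕ.+ k))
  lemma : ∀ x → x ≡ 1ℤ + (x - 1ℤ)
  lemma = solve-∀

-- Powers modulo powers of an odd prime

odd-∣-half : ∀ {n a} w → n ≡ 1ℤ + (w + w) → n ∣ℤ a + a → n ∣ℤ a
odd-∣-half {n} {a} w refl n∣2a =
  subst (n ∣ℤ_) (lemma a w) (∣m∣n⇒∣m-n (∣n⇒∣m*n a (∣-refl {n})) (∣n⇒∣m*n w n∣2a))
  where
  lemma : ∀ a w → a * (1ℤ + (w + w)) - w * (a + a) ≡ a
  lemma = solve-∀

odd-^ : ∀ w k → ∃[ w′ ] (1ℤ + (w + w)) ^ k ≡ 1ℤ + (w′ + w′)
odd-^ w zero    = 0ℤ , refl
odd-^ w (suc k) with odd-^ w k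
... | w′ , eq = w + w′ + (w + w) * w′ , trans (cong ((1ℤ + (w + w)) *_) eq) (lemma w w′)
  where
  lemma : ∀ w w′ → (1ℤ + (w + w)) * (1ℤ + (w′ + w′)) ≡ 1ℤ + ((w + w′ + (w + w) * w′) + (w + w′ + (w + w) * w′))
  lemma = solve-∀

-‿^-odd : ∀ u x → (- x) ^ suc (u ℕ.+ u) ≡ - (x ^ suc (u ℕ.+ u))
-‿^-odd zero    x = lemma x
  where
  lemma : ∀ x → (- x) * 1ℤ ≡ - (x * 1ℤ)
  lemma = solve-∀
-‿^-odd (suc u) x rewrite ℕP.+-suc u u =
  trans (cong (λ y → (- x) * ((- x) * y)) (-‿^-odd u x)) (lemma x (x ^ suc (u ℕ.+ u)))
  where
  lemma : ∀ x y → (- x) * ((- x) * (- y)) ≡ - (x * (x * y))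
  lemma = solve-∀

module _ (u : ℕ) where

  private
    p : ℕ
    p = suc (u ℕ.+ u)
    P : ℤ
    P = + p

  [1+y]ᵖ≡1+py : ∀ {y} → P ∣ℤ y → (1ℤ + y) ^ p ≡ 1ℤ + P * y [mod P * (y * y) ]
  [1+y]ᵖ≡1+py {y} P∣y = begin
    (1ℤ + y) ^ p                           ≈⟨ mod-weaken Py²∣y³ (binomial-mod-cube p y) ⟩
    1ℤ + P * y + + (p C 2) * (y * y)       ≈⟨ +-congˡ-mod (1ℤ + P * y) (∣⇒≡0-mod Py²∣quadratic-term) ⟩
    1ℤ + P * y + 0ℤ                        ≡⟨ ℤP.+-identityʳ (1ℤ + P * y) ⟩
    1ℤ + P * y                             ∎
    where
    open ≡-mod-Reasoning (P * (y * y))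
    Py²∣y³ : P * (y * y) ∣ℤ y * y * y
    Py²∣y³ = subst (_∣ℤ y * y * y) (ℤP.*-comm (y * y) P) (*-monoʳ-∣ (y * y) P∣y)
    lemma : ∀ P U Y → P * U * Y ≡ U * (P * Y)
    lemma = solve-∀
    Py²∣quadratic-term : P * (y * y) ∣ℤ + (p C 2) * (y * y)
    Py²∣quadratic-term = divides (+ u) (trans (cong (λ c → + c * (y * y)) (odd-C2 u))
                                        (trans (cong (_* (y * y)) (ℤP.pos-* p u)) (lemma P (+ u) (y * y))))

  D^pᵗ-1≡pᵗ[D-1] : ∀ t {D} → D ≡ 1ℤ [mod P ] → D ^ (p ℕ.^ t) - 1ℤ ≡ P ^ t * (D - 1ℤ) [mod P ^ (2 ℕ.+ t) ]
  D^pᵗ-1≡pᵗ[D-1] zero    {D} _ = mod-reflexive (lemma D)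
    where
    lemma : ∀ D → D * 1ℤ - 1ℤ ≡ 1ℤ * (D - 1ℤ)
    lemma = solve-∀
  D^pᵗ-1≡pᵗ[D-1] (suc t) {D} D≡1@(congruent P∣D-1) = begin
    D ^ (p ℕ.^ suc t) - 1ℤ        ≡⟨ cong (_- 1ℤ) D^pᵗ⁺¹≡[1+y]ᵖ ⟩
    (1ℤ + y) ^ p - 1ℤ             ≈⟨ sub-congʳ-mod 1ℤ (mod-weaken Pᵗ⁺³∣Py² ([1+y]ᵖ≡1+py P∣y)) ⟩
    1ℤ + P * y - 1ℤ               ≡⟨ lemma P y ⟩
    P * y                         ≈⟨ mod-*-scale P y≡Pᵗ[D-1] ⟩
    P * (P ^ t * (D - 1ℤ))        ≡⟨ ℤP.*-assoc P (P ^ t) (D - 1ℤ) ⟨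
    P ^ suc t * (D - 1ℤ)          ∎
    where
    open ≡-mod-Reasoning (P ^ (2 ℕ.+ suc t))
    y : ℤ
    y = D ^ (p ℕ.^ t) - 1ℤ
    y≡Pᵗ[D-1] : y ≡ P ^ t * (D - 1ℤ) [mod P ^ (2 ℕ.+ t) ]
    y≡Pᵗ[D-1] = D^pᵗ-1≡pᵗ[D-1] t D≡1
    Pᵗ⁺¹∣y : P ^ suc t ∣ℤ y
    Pᵗ⁺¹∣y = ∣-resp-mod y≡Pᵗ[D-1] (^-∣-^-suc P (suc t)) (^-suc-∣ P t P∣D-1)
    P∣y : P ∣ℤ y
    P∣y = ∣-trans (∣m⇒∣m*n (P ^ t) (∣-refl {P})) Pᵗ⁺¹∣y
    Pᵗ⁺³∣Py² : P ^ (2 ℕ.+ suc t) ∣ℤ P * (y * y)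
    Pᵗ⁺³∣Py² = *-monoʳ-∣ P (^-square-∣ P t Pᵗ⁺¹∣y)
    expand : ∀ x → x ≡ 1ℤ + (x - 1ℤ)
    expand = solve-∀
    D^pᵗ⁺¹≡[1+y]ᵖ : D ^ (p ℕ.^ suc t) ≡ (1ℤ + y) ^ p
    D^pᵗ⁺¹≡[1+y]ᵖ = trans (cong (D ^_) (ℕP.*-comm p (p ℕ.^ t)))
                   (trans (sym (ℤP.^-*-assoc D (p ℕ.^ t) p)) (cong (_^ p) (expand (D ^ (p ℕ.^ t)))))
    lemma : ∀ P y → 1ℤ + P * y - 1ℤ ≡ P * y
    lemma = solve-∀

  D^[pᵗm]≡1+mpᵗ[D-1] : ∀ t m {D} → D ≡ 1ℤ [mod P ] →
    D ^ (p ℕ.^ t ℕ.* m) ≡ 1ℤ + + m * (P ^ t * (D - 1ℤ)) [mod P ^ (2 ℕ.+ t) ]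
  D^[pᵗm]≡1+mpᵗ[D-1] t m {D} D≡1@(congruent P∣D-1) = begin
    D ^ (p ℕ.^ t ℕ.* m)           ≡⟨ ℤP.^-*-assoc D (p ℕ.^ t) m ⟨
    E ^ m                         ≈⟨ x^m≡1+m[x-1] m {P} {t} E≡1 ⟩
    1ℤ + + m * (E - 1ℤ)           ≈⟨ +-congˡ-mod 1ℤ (*-congˡ-mod (+ m) (D^pᵗ-1≡pᵗ[D-1] t D≡1)) ⟩
    1ℤ + + m * (P ^ t * (D - 1ℤ)) ∎
    where
    open ≡-mod-Reasoning (P ^ (2 ℕ.+ t))
    E : ℤ
    E = D ^ (p ℕ.^ t)
    E≡1 : E ≡ 1ℤ [mod P ^ suc t ]
    E≡1 = congruent (∣-resp-mod (D^pᵗ-1≡pᵗ[D-1] t D≡1) (^-∣-^-suc P (suc t)) (^-suc-∣ P t P∣D-1))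

  d^[1+[p-1]pᵗm]≡d+mpᵗ[dᵖ-d] : ∀ t m {d} → d ^ (u ℕ.+ u) ≡ 1ℤ [mod P ] →
    d ^ suc ((u ℕ.+ u) ℕ.* (p ℕ.^ t ℕ.* m)) ≡ d + + m * (P ^ t * (d ^ p - d)) [mod P ^ (2 ℕ.+ t) ]
  d^[1+[p-1]pᵗm]≡d+mpᵗ[dᵖ-d] t m {d} dᵖ⁻¹≡1 = begin
    d * d ^ ((u ℕ.+ u) ℕ.* (p ℕ.^ t ℕ.* m))      ≡⟨ cong (d *_) (ℤP.^-*-assoc d (u ℕ.+ u) (p ℕ.^ t ℕ.* m)) ⟨
    d * D ^ (p ℕ.^ t ℕ.* m)                     ≈⟨ *-congˡ-mod d (D^[pᵗm]≡1+mpᵗ[D-1] t m dᵖ⁻¹≡1) ⟩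
    d * (1ℤ + + m * (P ^ t * (D - 1ℤ)))         ≡⟨ lemma d D (+ m) (P ^ t) ⟩
    d + + m * (P ^ t * (d * D - d))             ∎
    where
    open ≡-mod-Reasoning (P ^ (2 ℕ.+ t))
    D : ℤ
    D = d ^ (u ℕ.+ u)
    lemma : ∀ d D M W → d * (1ℤ + M * (W * (D - 1ℤ))) ≡ d + M * (W * (d * D - d))
    lemma = solve-∀

  d^[[p-1]pᵗm]≡1 : ∀ t m {d} → d ^ (u ℕ.+ u) ≡ 1ℤ [mod P ] →
    d ^ ((u ℕ.+ u) ℕ.* (p ℕ.^ t ℕ.* m)) ≡ 1ℤ [mod P ^ suc t ]
  d^[[p-1]pᵗm]≡1 t m {d} dᵖ⁻¹≡1@(congruent P∣D-1) = begin
    d ^ ((u ℕ.+ u) ℕ.* (p ℕ.^ t ℕ.* m))      ≡⟨ ℤP.^-*-assoc d (u ℕ.+ u) (p ℕ.^ t ℕ.* m) ⟨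
    D ^ (p ℕ.^ t ℕ.* m)                      ≈⟨ mod-weaken (^-∣-^-suc P (suc t)) (D^[pᵗm]≡1+mpᵗ[D-1] t m dᵖ⁻¹≡1) ⟩
    1ℤ + + m * (P ^ t * (D - 1ℤ))            ≈⟨ +-congˡ-mod 1ℤ (∣⇒≡0-mod (∣n⇒∣m*n (+ m) (^-suc-∣ P t P∣D-1))) ⟩
    1ℤ + 0ℤ                                  ≡⟨⟩
    1ℤ                                       ∎
    where
    open ≡-mod-Reasoning (P ^ suc t)
    D : ℤ
    D = d ^ (u ℕ.+ u)

module _ {n : ℕ} where

  private
    N : ℕ
    N = suc n

  toℕ-mod : ∀ m → + toℕ (m mod N) ≡ + m [mod + N ]
  toℕ-mod m = congruent (divides (- + quotient) (begin
    + toℕ remainder - + m                                    ≡⟨ cong (λ k → + toℕ remainder - + k) property ⟩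
    + toℕ remainder - + (toℕ remainder ℕ.+ quotient ℕ.* N)   ≡⟨ cong (λ k → + toℕ remainder - k) m≡r+qN ⟩
    + toℕ remainder - (+ toℕ remainder + + quotient * + N)   ≡⟨ lemma (+ toℕ remainder) (+ quotient) (+ N) ⟩
    - + quotient * + N                                       ∎))
    where
    open DivMod (m divMod N)
    open ≡-Reasoning
    m≡r+qN : + (toℕ remainder ℕ.+ quotient ℕ.* N) ≡ + toℕ remainder + + quotient * + N
    m≡r+qN = trans (ℤP.pos-+ (toℕ remainder) (quotient ℕ.* N)) (cong (_+_ (+ toℕ remainder)) (ℤP.pos-* quotient N))
    lemma : ∀ r q N → r - (r + q * N) ≡ - q * N
    lemma = solve-∀

  ≤-residues-≡ : ∀ {a b} → a ≤ b → b < N → + b ≡ + a [mod + N ] → a ≡ b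
  ≤-residues-≡ {a} {b} a≤b b<N (congruent N∣b-a) = ℕP.≤-antisym a≤b (ℕP.m∸n≡0⇒m≤n b∸a≡0)
    where
    N∣b∸a : N ∣ b ∸ a
    N∣b∸a = subst (N ∣_)
      (trans (cong ℤ.∣_∣ (ℤP.m-n≡m⊖n b a)) (trans (ℤP.∣m⊖n∣≡∣n⊖m∣ b a) (ℤP.∣⊖∣-≤ a≤b))) (∣⇒∣ᵤ N∣b-a)
    b∸a≡0 : b ∸ a ≡ 0
    b∸a≡0 = trans (sym (m<n⇒m%n≡m (ℕP.≤-<-trans (ℕP.m∸n≤m b a) b<N))) (n∣m⇒m%n≡0 (b ∸ a) N N∣b∸a)

  residue-injective : ∀ {x y : Fin N} → + toℕ x ≡ + toℕ y [mod + N ] → x ≡ y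
  residue-injective {x} {y} x≡y with ℕP.≤-total (toℕ x) (toℕ y)
  ... | inj₁ x≤y = toℕ-injective (≤-residues-≡ x≤y (toℕ<n y) (mod-sym x≡y))
  ... | inj₂ y≤x = sym (toℕ-injective (≤-residues-≡ y≤x (toℕ<n x) x≡y))

  infixl 6 _⊝_
  infix  8 ⊝_

  -- Adding N ∸ y rather than subtracting y avoids truncated subtraction.
  _⊝_ : Fin N → Fin N → Fin N
  x ⊝ y = (toℕ x ℕ.+ (N ∸ toℕ y)) mod N

  ⊝_ : Fin N → Fin N
  ⊝ x = zero ⊝ x

  toℕ-⊝ : ∀ x y → + toℕ (x ⊝ y) ≡ + toℕ x - + toℕ y [mod + N ]
  toℕ-⊝ x y = mod-trans (toℕ-mod (toℕ x ℕ.+ (N ∸ toℕ y))) (congruent (divides 1ℤ (begin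
    + (toℕ x ℕ.+ (N ∸ toℕ y)) - (+ toℕ x - + toℕ y)       ≡⟨ cong (_- (+ toℕ x - + toℕ y)) x+[N-y]≡ ⟩
    + toℕ x + (+ N - + toℕ y) - (+ toℕ x - + toℕ y)       ≡⟨ lemma (+ toℕ x) (+ toℕ y) (+ N) ⟩
    1ℤ * + N                                              ∎)))
    where
    open ≡-Reasoning
    N∸y≡N-y : + (N ∸ toℕ y) ≡ + N - + toℕ y
    N∸y≡N-y = trans (sym (ℤP.⊖-≥ (ℕP.<⇒≤ (toℕ<n y)))) (sym (ℤP.m-n≡m⊖n N (toℕ y)))
    x+[N-y]≡ : + (toℕ x ℕ.+ (N ∸ toℕ y)) ≡ + toℕ x + (+ N - + toℕ y)
    x+[N-y]≡ = trans (ℤP.pos-+ (toℕ x) (N ∸ toℕ y)) (cong (_+_ (+ toℕ x)) N∸y≡N-y)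
    lemma : ∀ x y N → x + (N - y) - (x - y) ≡ 1ℤ * N
    lemma = solve-∀

  ⊝-⊝-neg : ∀ x y → x ⊝ y ⊝ ⊝ y ≡ x
  ⊝-⊝-neg x y = residue-injective (mod-trans (toℕ-⊝ (x ⊝ y) (⊝ y))
    (mod-trans (sub-cong-mod (toℕ-⊝ x y) (toℕ-⊝ zero y)) (mod-reflexive (lemma (+ toℕ x) (+ toℕ y)))))
    where
    lemma : ∀ x y → x - y - (0ℤ - y) ≡ x
    lemma = solve-∀

  ⊝-neg-⊝ : ∀ x y → x ⊝ ⊝ y ⊝ y ≡ x
  ⊝-neg-⊝ x y = residue-injective (mod-trans (toℕ-⊝ (x ⊝ ⊝ y) y)
    (mod-trans (sub-congʳ-mod (+ toℕ y) (mod-trans (toℕ-⊝ x (⊝ y)) (sub-congˡ-mod (+ toℕ x) (toℕ-⊝ zero y))))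
      (mod-reflexive (lemma (+ toℕ x) (+ toℕ y)))))
    where
    lemma : ∀ x y → x - (0ℤ - y) - y ≡ x
    lemma = solve-∀

  ⊝-involutive : ∀ x → ⊝ ⊝ x ≡ x
  ⊝-involutive x = residue-injective (mod-trans (toℕ-⊝ zero (⊝ x))
    (mod-trans (sub-congˡ-mod 0ℤ (toℕ-⊝ zero x)) (mod-reflexive (lemma (+ toℕ x)))))
    where
    lemma : ∀ x → 0ℤ - (0ℤ - x) ≡ x
    lemma = solve-∀

  ⊝≡zero⇒≡ : ∀ {x y} → x ⊝ y ≡ zero → x ≡ y
  ⊝≡zero⇒≡ {x} {y} x⊝y≡0 = residue-injective (congruent (≡0-mod⇒∣ (mod-sym
    (subst (λ z → + toℕ z ≡ + toℕ x - + toℕ y [mod + N ]) x⊝y≡0 (toℕ-⊝ x y)))))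

  nonzero-residue-∤ : ∀ {x} → x ≢ zero → ¬ (+ N ∣ℤ + toℕ x)
  nonzero-residue-∤ x≢0 N∣x = x≢0 (residue-injective (∣⇒≡0-mod N∣x))

private
  module ℤ-Sum = MonoidSum ℤP.+-0-commutativeMonoid

∑≡sum : ∀ n (f : Fin n → ℤ) → ∑ n f ≡ ℤ-Sum.sum f
∑≡sum zero    f = refl
∑≡sum (suc n) f = cong (_+_ (f zero)) (∑≡sum n (f ∘ suc))

∑-permute : ∀ n (f : Fin n → ℤ) (σ τ : Fin n → Fin n) → (∀ x → σ (τ x) ≡ x) → (∀ x → τ (σ x) ≡ x) →
  ∑ n (f ∘ σ) ≡ ∑ n f
∑-permute n f σ τ στ≗id τσ≗id = trans (∑≡sum n (f ∘ σ))
  (trans (sym (ℤ-Sum.sum-permute f (permutation σ τ στ≗id τσ≗id))) (sym (∑≡sum n f)))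

∑-cong-mod : ∀ k {n} {f g : Fin k → ℤ} → (∀ i → f i ≡ g i [mod n ]) → ∑ k f ≡ ∑ k g [mod n ]
∑-cong-mod zero    f≡g = mod-refl
∑-cong-mod (suc k) f≡g = +-cong-mod (f≡g zero) (∑-cong-mod k (f≡g ∘ suc))

∑-+ : ∀ k (f g : Fin k → ℤ) → ∑ k (λ i → f i + g i) ≡ ∑ k f + ∑ k g
∑-+ zero    f g = refl
∑-+ (suc k) f g = trans (cong (_+_ (f zero + g zero)) (∑-+ k (f ∘ suc) (g ∘ suc))) (lemma (f zero) (g zero) _ _)
  where
  lemma : ∀ a b c d → a + b + (c + d) ≡ a + c + (b + d)
  lemma = solve-∀

∑-neg : ∀ k (f : Fin k → ℤ) → ∑ k (λ i → - f i) ≡ - ∑ k f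
∑-neg zero    f = refl
∑-neg (suc k) f = trans (cong (_+_ (- f zero)) (∑-neg k (f ∘ suc))) (sym (ℤP.neg-distrib-+ (f zero) _))

∑-sub : ∀ k (f g : Fin k → ℤ) → ∑ k (λ i → f i - g i) ≡ ∑ k f - ∑ k g
∑-sub k f g = trans (∑-+ k f (λ i → - g i)) (cong (_+_ (∑ k f)) (∑-neg k g))

∑-*ˡ : ∀ k c (f : Fin k → ℤ) → ∑ k (λ i → c * f i) ≡ c * ∑ k f
∑-*ˡ zero    c f = sym (ℤP.*-zeroʳ c)
∑-*ˡ (suc k) c f = trans (cong (_+_ (c * f zero)) (∑-*ˡ k c (f ∘ suc))) (sym (ℤP.*-distribˡ-+ c (f zero) _))

∑-const : ∀ k c → ∑ k (λ _ → c) ≡ + k * c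
∑-const zero    c = refl
∑-const (suc k) c = trans (cong (_+_ c) (∑-const k c)) (lemma c (+ k))
  where
  lemma : ∀ c k → c + k * c ≡ (1ℤ + k) * c
  lemma = solve-∀

∑-affine : ∀ k c (f g : Fin k → ℤ) → ∑ k (λ i → f i + c * (g i - f i)) ≡ ∑ k f + c * (∑ k g - ∑ k f)
∑-affine k c f g = begin
  ∑ k (λ i → f i + c * (g i - f i))        ≡⟨ ∑-+ k f (λ i → c * (g i - f i)) ⟩
  ∑ k f + ∑ k (λ i → c * (g i - f i))      ≡⟨ cong (_+_ (∑ k f)) (∑-*ˡ k c (λ i → g i - f i)) ⟩
  ∑ k f + c * ∑ k (λ i → g i - f i)        ≡⟨ cong (λ s → ∑ k f + c * s) (∑-sub k g f) ⟩
  ∑ k f + c * (∑ k g - ∑ k f)              ∎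
  where open ≡-Reasoning

∑-≡1-except-one : ∀ k {n} (f : Fin (suc k) → ℤ) j → (∀ i → i ≢ j → f i ≡ 1ℤ [mod n ]) → f j ≡ 0ℤ [mod n ] →
  ∑ (suc k) f ≡ + k [mod n ]
∑-≡1-except-one k f zero fᵢ≡1 f₀≡0 = begin
  f zero + ∑ k (f ∘ suc)          ≈⟨ +-cong-mod f₀≡0 (∑-cong-mod k (λ i → fᵢ≡1 (suc i) λ ())) ⟩
  0ℤ + ∑ k (λ _ → 1ℤ)             ≡⟨ cong (_+_ 0ℤ) (∑-const k 1ℤ) ⟩
  0ℤ + + k * 1ℤ                   ≡⟨ trans (ℤP.+-identityˡ (+ k * 1ℤ)) (ℤP.*-identityʳ (+ k)) ⟩
  + k                             ∎
  where open ≡-mod-Reasoning _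
∑-≡1-except-one (suc k) f (suc j) fᵢ≡1 fⱼ≡0 =
  +-cong-mod (fᵢ≡1 zero λ ())
    (∑-≡1-except-one k (f ∘ suc) j (λ i i≢j → fᵢ≡1 (suc i) (i≢j ∘ suc-injective)) fⱼ≡0)

-- Power sums of differences of Teichmüller lifts

module TeichmüllerPowerSums
  (u t : ℕ) (p-prime : Prime (suc (u ℕ.+ u))) (T : Fin (suc (u ℕ.+ u)) → ℤ)
  (T-lift : ∀ μ → T μ ≡ + toℕ μ [mod + suc (u ℕ.+ u) ])
  (T-root : ∀ μ → T μ ^ suc (u ℕ.+ u) ≡ T μ [mod (+ suc (u ℕ.+ u)) ^ (2 ℕ.+ t) ])
  where

  private
    p : ℕ
    p = suc (u ℕ.+ u)
    P : ℤ
    P = + p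

  T-⊝ : ∀ μ ν → T (μ ⊝ ν) ≡ T μ - T ν [mod P ]
  T-⊝ μ ν = mod-trans (T-lift (μ ⊝ ν)) (mod-trans (toℕ-⊝ μ ν) (mod-sym (sub-cong-mod (T-lift μ) (T-lift ν))))

  T-neg : ∀ μ → T (⊝ μ) ≡ - T μ [mod P ^ (2 ℕ.+ t) ]
  T-neg μ = root-of-xᵖ-x-unique p (suc t) T[⊝μ]≡-Tμ (T-root (⊝ μ)) [-Tμ]ᵖ≡-Tμ
    where
    T[⊝μ]≡-Tμ : T (⊝ μ) ≡ - T μ [mod P ]
    T[⊝μ]≡-Tμ = mod-trans (T-⊝ zero μ)
      (mod-trans (sub-congʳ-mod (T μ) (T-lift zero)) (mod-reflexive (ℤP.+-identityˡ (- T μ))))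
    [-Tμ]ᵖ≡-Tμ : (- T μ) ^ p ≡ - T μ [mod P ^ (2 ℕ.+ t) ]
    [-Tμ]ᵖ≡-Tμ = mod-trans (mod-reflexive (-‿^-odd u (T μ))) (-‿cong-mod (T-root μ))

  ∑T≡0 : ∑ p T ≡ 0ℤ [mod P ^ (2 ℕ.+ t) ]
  ∑T≡0 with odd-^ (+ u) (2 ℕ.+ t)
  ... | w , Pᵗ⁺²≡1+2w =
    ∣⇒≡0-mod (odd-∣-half w Pᵗ⁺²≡1+2w (subst (_ ∣ℤ_) (lemma (∑ p T)) (difference-divisible ∑T≡-∑T)))
    where
    lemma : ∀ S → S - - S ≡ S + S
    lemma = solve-∀
    ∑T≡-∑T : ∑ p T ≡ - ∑ p T [mod P ^ (2 ℕ.+ t) ]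
    ∑T≡-∑T = mod-trans (mod-reflexive (sym (∑-permute p T ⊝_ ⊝_ ⊝-involutive ⊝-involutive)))
               (mod-trans (∑-cong-mod p T-neg) (mod-reflexive (∑-neg p T)))

  module _ (l : Fin p) where

    private
      d : Fin p → ℤ
      d μ = T μ - T l

    d^p≡T[μ⊝l] : ∀ μ → d μ ^ p ≡ T (μ ⊝ l) [mod P ^ 2 ]
    d^p≡T[μ⊝l] μ = mod-trans (^-lift-mod p 0 (mod-weaken (∣-reflexive (ℤP.*-identityʳ P)) (mod-sym (T-⊝ μ l))))
                             (mod-weaken (^-∣-^-+ P 2 t) (T-root (μ ⊝ l)))

    d^[p-1]≡1 : ∀ {μ} → μ ≢ l → d μ ^ (u ℕ.+ u) ≡ 1ℤ [mod P ]
    d^[p-1]≡1 {μ} μ≢l = aᵖ≡a⇒aᵖ⁻¹≡1 p-prime dᵖ≡d P∤d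
      where
      dᵖ≡d : d μ ^ p ≡ d μ [mod P ]
      dᵖ≡d = mod-trans (mod-weaken (∣m⇒∣m*n (P ^ 1) (∣-refl {P})) (d^p≡T[μ⊝l] μ)) (T-⊝ μ l)
      P∤d : ¬ (P ∣ℤ d μ)
      P∤d P∣d = nonzero-residue-∤ (μ≢l ∘ ⊝≡zero⇒≡)
        (∣-resp-mod (mod-sym (T-lift (μ ⊝ l))) ∣-refl (∣-resp-mod (T-⊝ μ l) ∣-refl P∣d))

    module _ (q : ℕ) (q≡[p-1]pᵗ* : ∃[ m ] q ≡ (u ℕ.+ u) ℕ.* (p ℕ.^ t ℕ.* m)) where

      private
        m : ℕ
        m = proj₁ q≡[p-1]pᵗ*
        q≡[p-1]pᵗm : q ≡ (u ℕ.+ u) ℕ.* (p ℕ.^ t ℕ.* m)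
        q≡[p-1]pᵗm = proj₂ q≡[p-1]pᵗ*
        c : ℤ
        c = + m * P ^ t

      d^[1+q]≡ : ∀ μ → d μ ^ suc q ≡ d μ + c * (T (μ ⊝ l) - d μ) [mod P ^ (2 ℕ.+ t) ]
      d^[1+q]≡ μ = begin
        d μ ^ suc q                                   ≈⟨ d^[1+q]≡-via-d^p ⟩
        d μ + + m * (P ^ t * (d μ ^ p - d μ))         ≈⟨ +-congˡ-mod (d μ) (*-congˡ-mod (+ m) (mod-^-scale P 2 t
                                                           (sub-congʳ-mod (d μ) (d^p≡T[μ⊝l] μ)))) ⟩
        d μ + + m * (P ^ t * (T (μ ⊝ l) - d μ))       ≡⟨ cong (_+_ (d μ)) (ℤP.*-assoc (+ m) (P ^ t) _) ⟨
        d μ + c * (T (μ ⊝ l) - d μ)                   ∎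
        where
        open ≡-mod-Reasoning (P ^ (2 ℕ.+ t))
        vanishing : ∀ {x} → x ≡ 0ℤ → x ^ suc q ≡ x + + m * (P ^ t * (x ^ p - x)) [mod P ^ (2 ℕ.+ t) ]
        vanishing refl = mod-reflexive (lemma (0ℤ ^ q) (0ℤ ^ (u ℕ.+ u)) (+ m) (P ^ t))
          where
          lemma : ∀ A B M W → 0ℤ * A ≡ 0ℤ + M * (W * (0ℤ * B - 0ℤ))
          lemma = solve-∀
        d^[1+q]≡-via-d^p : d μ ^ suc q ≡ d μ + + m * (P ^ t * (d μ ^ p - d μ)) [mod P ^ (2 ℕ.+ t) ]
        d^[1+q]≡-via-d^p with μ ≟ l
        ... | yes refl = vanishing (ℤP.+-inverseʳ (T l))
        ... | no μ≢l rewrite q≡[p-1]pᵗm = d^[1+[p-1]pᵗm]≡d+mpᵗ[dᵖ-d] u t m (d^[p-1]≡1 μ≢l)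

      ∑d^[1+q] : ∑ p (λ μ → d μ ^ suc q) ≡ - (T l * + suc q * P) [mod P ^ (2 ℕ.+ t) ]
      ∑d^[1+q] = begin
        ∑ p (λ μ → d μ ^ suc q)                         ≈⟨ ∑-cong-mod p d^[1+q]≡ ⟩
        ∑ p (λ μ → d μ + c * (T (μ ⊝ l) - d μ))         ≡⟨ ∑-affine p c d (T ∘ (_⊝ l)) ⟩
        ∑ p d + c * (∑ p (T ∘ (_⊝ l)) - ∑ p d)          ≡⟨ cong₂ (λ a b → a + c * (b - a)) ∑d≡ ∑T[μ⊝l]≡∑T ⟩
        (S - P * T l) + c * (S - (S - P * T l))         ≡⟨ lemma S (P * T l) c ⟩
        S + (c - 1ℤ) * (P * T l)                        ≈⟨ +-cong-mod ∑T≡0 (mod-refl {a = (c - 1ℤ) * (P * T l)}) ⟩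
        0ℤ + (c - 1ℤ) * (P * T l)                       ≈⟨ congruent (divides (T l * + m) Pᵗ⁺²∣difference) ⟩
        - (T l * + suc q * P)                           ∎
        where
        open ≡-mod-Reasoning (P ^ (2 ℕ.+ t))
        S : ℤ
        S = ∑ p T
        ∑d≡ : ∑ p d ≡ S - P * T l
        ∑d≡ = trans (∑-sub p T (λ _ → T l)) (cong (_-_ S) (∑-const p (T l)))
        ∑T[μ⊝l]≡∑T : ∑ p (T ∘ (_⊝ l)) ≡ S
        ∑T[μ⊝l]≡∑T = ∑-permute p T (_⊝ l) (_⊝ ⊝ l) (λ x → ⊝-neg-⊝ x l) (λ x → ⊝-⊝-neg x l)
        lemma : ∀ S A c → (S - A) + c * (S - (S - A)) ≡ S + (c - 1ℤ) * A
        lemma = solve-∀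
        1+q≡ : + suc q ≡ 1ℤ + + (u ℕ.+ u) * (P ^ t * + m)
        1+q≡ = cong (_+_ 1ℤ) (trans (cong +_ q≡[p-1]pᵗm) (trans (ℤP.pos-* (u ℕ.+ u) (p ℕ.^ t ℕ.* m))
                 (cong (+ (u ℕ.+ u) *_) (trans (ℤP.pos-* (p ℕ.^ t) m) (cong (_* + m) (pos-^ p t))))))
        identity : ∀ x M W U → 0ℤ + (M * W - 1ℤ) * ((1ℤ + U) * x) - - (x * (1ℤ + U * (W * M)) * (1ℤ + U))
                     ≡ x * M * ((1ℤ + U) * ((1ℤ + U) * W))
        identity = solve-∀
        Pᵗ⁺²∣difference : 0ℤ + (c - 1ℤ) * (P * T l) - - (T l * + suc q * P) ≡ T l * + m * P ^ (2 ℕ.+ t)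
        Pᵗ⁺²∣difference = trans (cong (λ r → 0ℤ + (c - 1ℤ) * (P * T l) - - (T l * r * P)) 1+q≡)
                                (identity (T l) (+ m) (P ^ t) (+ (u ℕ.+ u)))

      ∑d^q : 0 < q → ∑ p (λ μ → d μ ^ q) ≡ P - 1ℤ [mod P ^ suc t ]
      ∑d^q 0<q = mod-trans (∑-≡1-except-one (u ℕ.+ u) (λ μ → d μ ^ q) l
        (λ μ μ≢l → subst (λ k → d μ ^ k ≡ 1ℤ [mod P ^ suc t ]) (sym q≡[p-1]pᵗm)
                     (d^[[p-1]pᵗm]≡1 u t m (d^[p-1]≡1 μ≢l)))
        (mod-reflexive (trans (cong (_^ q) (ℤP.+-inverseʳ (T l))) (0^-pos 0<q))))
        (mod-reflexive (lemma (+ (u ℕ.+ u))))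
        where
        lemma : ∀ U → U ≡ (1ℤ + U) - 1ℤ
        lemma = solve-∀

parity : ∀ n → (∃[ u ] n ≡ u ℕ.+ u) ⊎ (∃[ u ] n ≡ suc (u ℕ.+ u))
parity zero    = inj₁ (0 , refl)
parity (suc n) with parity n
... | inj₁ (u , refl) = inj₂ (u , refl)
... | inj₂ (u , refl) = inj₁ (suc u , cong suc (sym (ℕP.+-suc u u)))

odd-prime : ∀ {p} → Prime p → 2 < p → ∃[ u ] p ≡ suc (u ℕ.+ u)
odd-prime {p} p-prime 2<p with parity p
... | inj₂ p-odd = p-odd
... | inj₁ (u , refl)
  with prime⇒irreducible p-prime (divides u (trans (cong (u ℕ.+_) (sym (ℕP.+-identityʳ u))) (ℕP.*-comm 2 u)))
...   | inj₁ ()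
...   | inj₂ 2≡p = ⊥-elim (ℕP.<-irrefl 2≡p 2<p)

[1+n]ᵗ≡1+sn : ∀ n t → ∃[ s ] suc n ℕ.^ t ≡ 1 ℕ.+ s ℕ.* n
[1+n]ᵗ≡1+sn n zero    = 0 , refl
[1+n]ᵗ≡1+sn n (suc t) with [1+n]ᵗ≡1+sn n t
... | s , eq = s ℕ.+ (1 ℕ.+ s ℕ.* n) , trans (cong (suc n ℕ.*_) eq) (lemma n s)
  where
  lemma : ∀ n s → suc n ℕ.* (1 ℕ.+ s ℕ.* n) ≡ 1 ℕ.+ (s ℕ.+ (1 ℕ.+ s ℕ.* n)) ℕ.* n
  lemma = ℕ-Ring.solve-∀

n∣x∧[1+n]ᵗ∣x⇒n[1+n]ᵗ∣x : ∀ n t {x} → n ∣ x → suc n ℕ.^ t ∣ x → ∃[ m ] x ≡ n ℕ.* (suc n ℕ.^ t ℕ.* m)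
n∣x∧[1+n]ᵗ∣x⇒n[1+n]ᵗ∣x n t {x} n∣x (divides b x≡b[1+n]ᵗ) with [1+n]ᵗ≡1+sn n t
... | s , expansion with ∣m+n∣m⇒∣n (subst (n ∣_) x≡bsn+b n∣x) (n∣m*n (b ℕ.* s))
  where
  x≡bsn+b : x ≡ b ℕ.* s ℕ.* n ℕ.+ b
  x≡bsn+b = trans x≡b[1+n]ᵗ (trans (cong (b ℕ.*_) expansion) (lemma b s n))
    where
    lemma : ∀ b s n → b ℕ.* (1 ℕ.+ s ℕ.* n) ≡ b ℕ.* s ℕ.* n ℕ.+ b
    lemma = ℕ-Ring.solve-∀
... | divides m b≡mn = m , trans x≡b[1+n]ᵗ (trans (cong (ℕ._* suc n ℕ.^ t) b≡mn) (lemma m n (suc n ℕ.^ t)))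
  where
  lemma : ∀ m n Q → m ℕ.* n ℕ.* Q ≡ n ℕ.* (Q ℕ.* m)
  lemma = ℕ-Ring.solve-∀

≋⇒≡-mod : ∀ {a b} m → a ≋ b [mod m ] → a ≡ b [mod + m ]
≋⇒≡-mod m m∣a-b = congruent (∣ᵤ⇒∣ m∣a-b)

≋-^⇒≡-mod : ∀ {a b} p {i j} → i ≡ j → a ≋ b [mod p ℕ.^ i ] → a ≡ b [mod (+ p) ^ j ]
≋-^⇒≡-mod p {i} refl a≡b = subst (λ n → _ ≡ _ [mod n ]) (pos-^ p i) (≋⇒≡-mod (p ℕ.^ i) a≡b)

≡-mod-^⇒≋ : ∀ {a b} p {i j} → i ≡ j → a ≡ b [mod (+ p) ^ i ] → a ≋ b [mod p ℕ.^ j ]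
≡-mod-^⇒≋ p {i} refl a≡b = ∣⇒∣ᵤ (difference-divisible (subst (λ n → _ ≡ _ [mod n ]) (sym (pos-^ p i)) a≡b))

corollary2p5 : (p r t : ℕ) → Prime p → 2 < p → 1 < r → (p ∸ 1) ∣ (r ∸ 1) → IsPVal p (r ∸ 1) t → (T : Fin p → ℤ) → IsTeichmullerMod p (t ℕ.+ 2) T → (l : Fin p) → (∑ p (λ μ → (T μ - T l) ^ r) ≋ - (T l * + r * + p) [mod p ℕ.^ (t ℕ.+ 2) ]) × (∑ p (λ μ → (T μ - T l) ^ (r ∸ 1)) ≋ (+ p - + 1) [mod p ℕ.^ (t ℕ.+ 1) ])
corollary2p5 p (suc q) t p-prime 2<p (s≤s 0<q) p-1∣q (pᵗ∣q , _) T (T-lift , T-root) l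
  with odd-prime p-prime 2<p
... | u , refl =
  ≡-mod-^⇒≋ p (ℕP.+-comm 2 t) (∑d^[1+q] l q r-1≡[p-1]pᵗm) ,
  ≡-mod-^⇒≋ p (ℕP.+-comm 1 t) (∑d^q l q r-1≡[p-1]pᵗm 0<q)
  where
  open TeichmüllerPowerSums u t p-prime T
    (λ μ → ≋⇒≡-mod p (T-lift μ)) (λ μ → ≋-^⇒≡-mod p (ℕP.+-comm t 2) (T-root μ))
  r-1≡[p-1]pᵗm : ∃[ m ] q ≡ (u ℕ.+ u) ℕ.* (p ℕ.^ t ℕ.* m)
  r-1≡[p-1]pᵗm = n∣x∧[1+n]ᵗ∣x⇒n[1+n]ᵗ∣x (u ℕ.+ u) t p-1∣q pᵗ∣q
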